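{- A finite simple graph $G$ is a caterpillar forest if and only if it admits a $CF$-free circular ordering.
   Context: A caterpillar is a tree in which deleting all leaves leaves a path (equivalently, a tree not containing as a subgraph the tree obtained from the claw $K_{1,3}$ by subdividing each edge once); a caterpillar forest is a graph each of whose components is a caterpillar. A circular ordering of a finite set $X$ is a ternary relation $C\subseteq X^3$ such that for all $x,y,z,w\in X$: $(x,y,z)\in C\Rightarrow(y,z,x)\in C$; $(x,y,z)\in C\Rightarrow(x,z,y)\notin C$; $(x,y,z),(x,z,w)\in C\Rightarrow(x,y,w)\in C$; and for distinct $x,y,z$ either $(x,y,z)\in C$ or $(x,z,y)\in C$. Vertices appear in circular order $a_1,\dots,a_m$ if $(a_1,a_i,a_j)\in C$ for all $1<i<j\le m$. A circular ordering $C$ of $V(G)$ is $CF$-free if $G$ has no induced triangle, no induced $4$-cycle (in any circular order), and no induced path $x_1x_2x_3x_4$ (edges $x_1x_2,x_2x_3,x_3x_4$) whose vertices appear in circular order $x_1,x_2,x_3,x_4$ or in circular order $x_1,x_3,x_2,x_4$. -}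

module Defs where

open import Data.Nat using (ℕ; zero; suc)
open import Data.Fin using (Fin; zero; suc; inject₁; fromℕ)
open import Data.Product using (Σ; ∃; _×_; _,_)
open import Data.Sum using (_⊎_)
open import Data.Empty using (⊥)
open import Relation.Nullary using (¬_; Dec)
open import Relation.Binary.PropositionalEquality using (_≡_)
open import Function.Definitions using (Injective)
open import Level using (Level; suc; _⊔_) renaming (zero to 0ℓ)

record Graph (n : ℕ) : Set₁ where
  field
    Adj    : Fin n → Fin n → Set
    sym    : ∀ {x y} → Adj x y → Adj y x
    irrefl : ∀ {x} → ¬ Adj x x
    dec    : ∀ x y → Dec (Adj x y)

module _ {n : ℕ} (G : Graph n) where
  open Graph G

  HasCycle : Set
  HasCycle = Σ ℕ λ k → Σ (Fin (Data.Nat.suc (Data.Nat.suc (Data.Nat.suc k))) → Fin n) λ f →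
    Injective _≡_ _≡_ f
    × (∀ (i : Fin (Data.Nat.suc (Data.Nat.suc k))) → Adj (f (inject₁ i)) (f (Fin.suc i)))
    × Adj (f (fromℕ _)) (f Fin.zero)

  IsForest : Set
  IsForest = ¬ HasCycle

  -- G contains (as a not necessarily induced subgraph) the claw K_{1,3} with each
  -- edge subdivided once: centre f0, neighbours f1 f2 f3, and fi adjacent to f(i+3).
  HasSubdividedClaw : Set
  HasSubdividedClaw = Σ (Fin 7 → Fin n) λ f →
    Injective _≡_ _≡_ f
    × Adj (f (# 0)) (f (# 1)) × Adj (f (# 0)) (f (# 2)) × Adj (f (# 0)) (f (# 3))
    × Adj (f (# 1)) (f (# 4)) × Adj (f (# 2)) (f (# 5)) × Adj (f (# 3)) (f (# 6))
    where open import Data.Fin using (#_)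

  -- Caterpillar forest: every component is a caterpillar, i.e. a tree with no
  -- subdivided claw as a subgraph.
  IsCaterpillarForest : Set
  IsCaterpillarForest = IsForest × ¬ HasSubdividedClaw

record IsCircularOrdering {n : ℕ} (C : Fin n → Fin n → Fin n → Set) : Set where
  field
    cyclic     : ∀ {x y z} → C x y z → C y z x
    asym       : ∀ {x y z} → C x y z → ¬ C x z y
    trans      : ∀ {x y z w} → C x y z → C x z w → C x y w
    total      : ∀ {x y z} → ¬ x ≡ y → ¬ y ≡ z → ¬ x ≡ z → C x y z ⊎ C x z y

InCircOrder4 : {n : ℕ} → (Fin n → Fin n → Fin n → Set) → Fin n → Fin n → Fin n → Fin n → Set
InCircOrder4 C a₁ a₂ a₃ a₄ = C a₁ a₂ a₃ × C a₁ a₂ a₄ × C a₁ a₃ a₄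

module _ {n : ℕ} (G : Graph n) where
  open Graph G

  Distinct4 : Fin n → Fin n → Fin n → Fin n → Set
  Distinct4 a b c d = ¬ a ≡ b × ¬ a ≡ c × ¬ a ≡ d × ¬ b ≡ c × ¬ b ≡ d × ¬ c ≡ d

  -- triangle (automatically induced, on distinct vertices by irreflexivity)
  Triangle : Fin n → Fin n → Fin n → Set
  Triangle x y z = Adj x y × Adj y z × Adj x z

  Induced4Cycle : Fin n → Fin n → Fin n → Fin n → Set
  Induced4Cycle x₁ x₂ x₃ x₄ = Distinct4 x₁ x₂ x₃ x₄
    × Adj x₁ x₂ × Adj x₂ x₃ × Adj x₃ x₄ × Adj x₄ x₁
    × ¬ Adj x₁ x₃ × ¬ Adj x₂ x₄

  InducedP4 : Fin n → Fin n → Fin n → Fin n → Set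
  InducedP4 x₁ x₂ x₃ x₄ = Distinct4 x₁ x₂ x₃ x₄
    × Adj x₁ x₂ × Adj x₂ x₃ × Adj x₃ x₄
    × ¬ Adj x₁ x₃ × ¬ Adj x₂ x₄ × ¬ Adj x₁ x₄

  IsCFFree : (Fin n → Fin n → Fin n → Set) → Set
  IsCFFree C =
      (∀ x y z → ¬ Triangle x y z)
    × (∀ x₁ x₂ x₃ x₄ → ¬ Induced4Cycle x₁ x₂ x₃ x₄)
    × (∀ x₁ x₂ x₃ x₄ → InducedP4 x₁ x₂ x₃ x₄ →
         ¬ (InCircOrder4 C x₁ x₂ x₃ x₄ ⊎ InCircOrder4 C x₁ x₃ x₂ x₄))

  HasCFFreeCircularOrdering : Set₁
  HasCFFreeCircularOrdering =
    Σ (Fin n → Fin n → Fin n → Set) λ C → IsCircularOrdering C × IsCFFree C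

-- A circular ordering is CF-free exactly when the graph is triangle- and C4-free and every
-- path abcd alternates: the triples abc and bcd have opposite orientations.  Alternation rules
-- out a subdivided claw, whose three legs would have pairwise opposite orientations around the
-- centre, and a cycle, along which a winding count of the walk run twice around would be both
-- at most and more than its length; so the graph is a caterpillar forest.  Conversely, a
-- caterpillar forest has a vertex that is isolated or a leaf whose neighbour's surroundings
-- are small (otherwise there is a subdivided claw).  Remove it, place the rest by induction,
-- and put it back immediately after a suitable anchor vertex: every path stays alternating.

module Submission where

open import Defs
open import Data.Empty using (⊥; ⊥-elim)
open import Data.Fin using (Fin; zero; suc; _≟_; toℕ; fromℕ; fromℕ<; inject₁; punchIn; punchOut; #_)
open import Data.Fin.Properties
  using (any?; pigeonhole; toℕ<n; toℕ-injective; toℕ-fromℕ; toℕ-fromℕ<; toℕ-inject₁;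
         punchIn-injective; punchInᵢ≢i; punchIn-punchOut; punchOut-cong; punchOut-punchIn)
  renaming (suc-injective to Fin-suc-injective)
open import Data.Nat using (ℕ; zero; suc; _+_; _*_; _∸_; _≤_; _<_; s≤s; s≤s⁻¹; z≤n; NonZero; _%_)
open import Data.Nat.DivMod using (m%n<n; m%n%n≡m%n; %-distribˡ-+; m<n⇒m%n≡m; [m+n]%n≡m%n; n%n≡0)
open import Data.Nat.Properties
  using (<-cmp; <-irrefl; <-asym; <-trans; <-≤-connex; ≤-refl; ≤-trans; n<1+n; 1+n≰n; m≤m+n;
         m≤n⇒m<n∨m≡n; suc-injective; +-suc; +-comm; +-assoc; +-identityʳ; +-mono-≤; +-mono-<;
         +-monoʳ-≤; +-cancelʳ-≡; m∸n+n≡m; m<n+o⇒m∸n<o; *-suc; *-monoʳ-<; *-monoʳ-≤; *-cancelˡ-≡;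
         even≢odd)
open import Data.Nat.Tactic.RingSolver using (solve-∀)
open import Data.Product using (Σ; ∃; _×_; _,_; proj₁; proj₂)
open import Data.Sum using (_⊎_; inj₁; inj₂)
open import Data.Vec.Functional using ([]; _∷_)
open import Function using (_∘_)
open import Function.Definitions using (Injective)
open import Relation.Binary using (tri<; tri≈; tri>)
open import Relation.Binary.PropositionalEquality
  using (_≡_; _≢_; refl; sym; trans; subst; subst₂; cong; cong₂; ≢-sym; module ≡-Reasoning)
open import Relation.Nullary using (¬_; Dec; yes; no)
open import Relation.Nullary.Decidable using (_×-dec_; ¬?; False; toWitnessFalse)

Ternary : ℕ → Set₁
Ternary n = Fin n → Fin n → Fin n → Set

module CircularOrder {n : ℕ} {C : Ternary n} (CO : IsCircularOrdering C) where
  open IsCircularOrdering CO renaming (trans to C-trans)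

  rotate² : ∀ {x y z} → C x y z → C z x y
  rotate² h = cyclic (cyclic h)

  ¬C-xyy : ∀ {x y} → ¬ C x y y
  ¬C-xyy h = asym h h

  ¬C-xyx : ∀ {x y} → ¬ C x y x
  ¬C-xyx h = ¬C-xyy (cyclic h)

  ¬C-xxy : ∀ {x y} → ¬ C x x y
  ¬C-xxy h = ¬C-xyy (rotate² h)

  C⇒≢₁₂ : ∀ {x y z} → C x y z → x ≢ y
  C⇒≢₁₂ h refl = ¬C-xxy h

  C⇒≢₂₃ : ∀ {x y z} → C x y z → y ≢ z
  C⇒≢₂₃ h refl = ¬C-xyy h

  C⇒≢₁₃ : ∀ {x y z} → C x y z → x ≢ z
  C⇒≢₁₃ h refl = ¬C-xyx h

  -- Abstract, so that `rewrite indicator-yes (C? x y z) _` can find C? x y z in goals.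
  abstract
    C? : ∀ x y z → Dec (C x y z)
    C? x y z with x ≟ y | y ≟ z | x ≟ z
    ... | yes refl | _ | _ = no ¬C-xxy
    ... | no _ | yes refl | _ = no ¬C-xyy
    ... | no _ | no _ | yes refl = no ¬C-xyx
    ... | no x≢y | no y≢z | no x≢z with total x≢y y≢z x≢z
    ...   | inj₁ h = yes h
    ...   | inj₂ h = no (asym h)

  flip : ∀ {x y z} → x ≢ y → y ≢ z → x ≢ z → ¬ C x y z → C x z y
  flip x≢y y≢z x≢z ¬h with total x≢y y≢z x≢z
  ... | inj₁ h = ⊥-elim (¬h h)
  ... | inj₂ h = h

  chain : ∀ {a x y z} → C a x y → C a y z → C x y z
  chain h₁ h₂ = rotate² (C-trans (cyclic h₂) (rotate² h₁))

  ImmediatelyAfter : Fin n → Fin n → Set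
  ImmediatelyAfter α r = ∀ z → z ≢ α → z ≢ r → C α r z

  immediatelyAfter-forward : ∀ {α r x y} → ImmediatelyAfter α r → x ≢ r → C x y α → C x y r
  immediatelyAfter-forward α→r x≢r xyα =
    cyclic (chain (α→r _ (C⇒≢₁₃ xyα) x≢r) (rotate² xyα))

  immediatelyAfter-backward : ∀ {α r x y} → ImmediatelyAfter α r → x ≢ α → y ≢ α →
    C x y r → C x y α
  immediatelyAfter-backward {α} {r} {x} {y} α→r x≢α y≢α xyr with C? x y α
  ... | yes xyα = xyα
  ... | no ¬xyα = ⊥-elim (asym (rotate² xyr)
                               (chain (α→r y y≢α (C⇒≢₂₃ xyr))
                                      (cyclic (flip (C⇒≢₁₂ xyr) y≢α x≢α ¬xyα))))

-- Alternating paths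

ExactlyOne : Set → Set → Set
ExactlyOne P Q = (P → ¬ Q) × (¬ P → Q)

exactlyOne-triangle : ∀ {P Q R} → Dec P → ExactlyOne P Q → ExactlyOne Q R → ExactlyOne P R → ⊥
exactlyOne-triangle (yes p) (p⇒¬q , _) (_ , ¬q⇒r) (p⇒¬r , _) = p⇒¬r p (¬q⇒r (p⇒¬q p))
exactlyOne-triangle (no ¬p) (_ , ¬p⇒q) (q⇒¬r , _) (_ , ¬p⇒r) = q⇒¬r (¬p⇒q ¬p) (¬p⇒r ¬p)

-- Geometrically: the chord bc separates a from d.
Alternating : ∀ {n} → Ternary n → Fin n → Fin n → Fin n → Fin n → Set
Alternating C a b c d = ExactlyOne (C a b c) (C b c d)

PathAlternating : ∀ {n} → Graph n → Ternary n → Set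
PathAlternating G C =
  ∀ a b c d → Distinct4 G a b c d → Adj a b → Adj b c → Adj c d → Alternating C a b c d
  where open Graph G

module _ {n : ℕ} (G : Graph n) where
  open Graph G renaming (sym to adj-sym)

  distinct4-reverse : ∀ {a b c d} → Distinct4 G a b c d → Distinct4 G d c b a
  distinct4-reverse (a≢b , a≢c , a≢d , b≢c , b≢d , c≢d) =
    ≢-sym c≢d , ≢-sym b≢d , ≢-sym a≢d , ≢-sym b≢c , ≢-sym a≢c , ≢-sym a≢b

  module _ {C : Ternary n} (CO : IsCircularOrdering C) where
    open IsCircularOrdering CO using (cyclic; asym) renaming (trans to C-trans)
    open CircularOrder CO

    alternating-reverse : ∀ {a b c d} → Distinct4 G a b c d →
      Alternating C a b c d → Alternating C d c b a
    alternating-reverse {a} {b} {c} {d} (a≢b , a≢c , _ , b≢c , b≢d , c≢d) (f₁ , f₂) = g₁ , g₂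
      where
      g₁ : C d c b → ¬ C c b a
      g₁ h with C? a b c
      ... | yes h₁ = asym (rotate² h₁)
      ... | no ¬h₁ = ⊥-elim (asym (rotate² h) (f₂ ¬h₁))
      g₂ : ¬ C d c b → C c b a
      g₂ ¬h with C? a b c
      ... | yes h₁ = ⊥-elim (f₁ h₁ (cyclic (flip (≢-sym c≢d) (≢-sym b≢c) (≢-sym b≢d) ¬h)))
      ... | no ¬h₁ = cyclic (flip a≢b b≢c a≢c ¬h₁)

    -- A CF-free ordering excludes triangles and induced C4s, so every path abcd is an induced
    -- P4; the forbidden orders of abcd and of dcba together are exactly the cyclic orders in
    -- which abc and bcd have the same orientation.
    cfFree⇒pathAlternating : IsCFFree G C → PathAlternating G C
    cfFree⇒pathAlternating (noTriangle , noSquare , noBadP4) a b c d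
                            dist@(a≢b , a≢c , a≢d , b≢c , b≢d , c≢d) ab bc cd = f₁ , f₂
      where
      ¬ac : ¬ Adj a c
      ¬ac ac = noTriangle a b c (ab , bc , ac)
      ¬bd : ¬ Adj b d
      ¬bd bd = noTriangle b c d (bc , cd , bd)
      ¬ad : ¬ Adj a d
      ¬ad ad = noSquare a b c d (dist , ab , bc , cd , adj-sym ad , ¬ac , ¬bd)
      p4 : InducedP4 G a b c d
      p4 = dist , ab , bc , cd , ¬ac , ¬bd , ¬ad
      p4ʳ : InducedP4 G d c b a
      p4ʳ = distinct4-reverse dist , adj-sym cd , adj-sym bc , adj-sym ab ,
            (λ e → ¬bd (adj-sym e)) , (λ e → ¬ac (adj-sym e)) , (λ e → ¬ad (adj-sym e))
      f₁ : C a b c → ¬ C b c d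
      f₁ abc bcd with C? a c d | C? a b d
      ... | yes acd | _ = noBadP4 a b c d p4 (inj₁ (abc , C-trans abc acd , acd))
      ... | no ¬acd | yes abd = asym bcd (chain abd (flip a≢c c≢d a≢d ¬acd))
      ... | no ¬acd | no ¬abd = noBadP4 d c b a p4ʳ (inj₂ (chain adb abc , cyclic adb , cyclic adc))
        where
        adb = flip a≢b b≢d a≢d ¬abd
        adc = flip a≢c c≢d a≢d ¬acd
      f₂ : ¬ C a b c → C b c d
      f₂ ¬abc with C? b c d
      ... | yes bcd = bcd
      ... | no ¬bcd with C? a b d | C? a d c
      ...   | yes abd | _ = ⊥-elim (noBadP4 a b c d p4 (inj₂ (acb , C-trans acb abd , abd)))
        where acb = flip a≢b b≢c a≢c ¬abc
      ...   | no ¬abd | yes adc =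
        ⊥-elim (noBadP4 d c b a p4ʳ (inj₁ (chain adc acb , cyclic adc , cyclic adb)))
        where
        acb = flip a≢b b≢c a≢c ¬abc
        adb = flip a≢b b≢d a≢d ¬abd
      ...   | no ¬abd | no ¬adc =
        ⊥-elim (asym (rotate² (chain (flip a≢d (≢-sym c≢d) a≢c ¬adc) (flip a≢b b≢d a≢d ¬abd)))
                     (flip b≢c c≢d b≢d ¬bcd))

    pathAlternating⇒cfFree : (∀ x y z → ¬ Triangle G x y z) →
      (∀ x₁ x₂ x₃ x₄ → ¬ Induced4Cycle G x₁ x₂ x₃ x₄) → PathAlternating G C → IsCFFree G C
    pathAlternating⇒cfFree noTriangle noSquare alt = noTriangle , noSquare , noBadP4
      where
      noBadP4 : ∀ x₁ x₂ x₃ x₄ → InducedP4 G x₁ x₂ x₃ x₄ →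
        ¬ (InCircOrder4 C x₁ x₂ x₃ x₄ ⊎ InCircOrder4 C x₁ x₃ x₂ x₄)
      noBadP4 x₁ x₂ x₃ x₄ (dist , e₁₂ , e₂₃ , e₃₄ , _) (inj₁ (c₁₂₃ , _ , c₁₃₄)) =
        proj₁ (alt x₁ x₂ x₃ x₄ dist e₁₂ e₂₃ e₃₄) c₁₂₃ (chain c₁₂₃ c₁₃₄)
      noBadP4 x₁ x₂ x₃ x₄ (dist , e₁₂ , e₂₃ , e₃₄ , _) (inj₂ (c₁₃₂ , _ , c₁₂₄)) =
        asym (proj₂ (alt x₁ x₂ x₃ x₄ dist e₁₂ e₂₃ e₃₄) (asym c₁₃₂)) (cyclic (chain c₁₃₂ c₁₂₄))

module _ {n : ℕ} (G : Graph n) {C : Ternary n} (CO : IsCircularOrdering C) where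
  open Graph G renaming (sym to adj-sym)
  open IsCircularOrdering CO using (cyclic; asym)
  open CircularOrder CO

  legs-opposite : PathAlternating G C → ∀ {aᵢ bᵢ c bⱼ aⱼ} →
    Distinct4 G aᵢ bᵢ c bⱼ → Distinct4 G bᵢ c bⱼ aⱼ →
    Adj aᵢ bᵢ → Adj bᵢ c → Adj c bⱼ → Adj bⱼ aⱼ → ExactlyOne (C aᵢ bᵢ c) (C aⱼ bⱼ c)
  legs-opposite alt {aᵢ} {bᵢ} {c} {bⱼ} {aⱼ} dᵢ dⱼ@(_ , _ , _ , c≢bⱼ , c≢aⱼ , bⱼ≢aⱼ) e₁ e₂ e₃ e₄ =
    (λ h → asym (rotate² (proj₂ A₂ (proj₁ A₁ h)))) ,
    (λ ¬h → flip (≢-sym c≢aⱼ) c≢bⱼ (≢-sym bⱼ≢aⱼ) (λ h → proj₁ A₂ (proj₂ A₁ ¬h) (cyclic h)))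
    where
    A₁ = alt aᵢ bᵢ c bⱼ dᵢ e₁ e₂ e₃
    A₂ = alt bᵢ c bⱼ aⱼ dⱼ e₂ e₃ e₄

  -- The three legs of a subdivided claw would have pairwise opposite orientations.
  noSubdividedClaw : PathAlternating G C → ¬ HasSubdividedClaw G
  noSubdividedClaw alt (f , inj , e01 , e02 , e03 , e14 , e25 , e36) =
    exactlyOne-triangle (C? (f (# 4)) (f (# 1)) (f (# 0)))
      (legs-opposite alt (d4 (# 4) (# 1) (# 0) (# 2))
                         (d4 (# 1) (# 0) (# 2) (# 5))
                         (adj-sym e14) (adj-sym e01) e02 e25)
      (legs-opposite alt (d4 (# 5) (# 2) (# 0) (# 3))
                         (d4 (# 2) (# 0) (# 3) (# 6))
                         (adj-sym e25) (adj-sym e02) e03 e36)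
      (legs-opposite alt (d4 (# 4) (# 1) (# 0) (# 3))
                         (d4 (# 1) (# 0) (# 3) (# 6))
                         (adj-sym e14) (adj-sym e01) e03 e36)
    where
    d4 : ∀ a b c d → {False (a ≟ b)} → {False (a ≟ c)} → {False (a ≟ d)} → {False (b ≟ c)} →
      {False (b ≟ d)} → {False (c ≟ d)} → Distinct4 G (f a) (f b) (f c) (f d)
    d4 _ _ _ _ {a≢b} {a≢c} {a≢d} {b≢c} {b≢d} {c≢d} =
      apart a≢b , apart a≢c , apart a≢d , apart b≢c , apart b≢d , apart c≢d
      where
      apart : ∀ {i j} → False (i ≟ j) → f i ≢ f j
      apart i≢j e = toWitnessFalse i≢j (inj e)

-- Winding around a cycle

indicator : ∀ {P : Set} → Dec P → ℕ
indicator (yes _) = 1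
indicator (no _) = 0

indicator-yes : ∀ {P : Set} (d : Dec P) → P → indicator d ≡ 1
indicator-yes (yes _) _ = refl
indicator-yes (no ¬p) p = ⊥-elim (¬p p)

indicator-no : ∀ {P : Set} (d : Dec P) → ¬ P → indicator d ≡ 0
indicator-no (yes p) ¬p = ⊥-elim (¬p p)
indicator-no (no _) _ = refl

sumBelow : ℕ → (ℕ → ℕ) → ℕ
sumBelow zero f = 0
sumBelow (suc m) f = sumBelow m f + f m

sumBelow-cong : ∀ m {f g : ℕ → ℕ} → (∀ j → f j ≡ g j) → sumBelow m f ≡ sumBelow m g
sumBelow-cong zero e = refl
sumBelow-cong (suc m) e = cong₂ _+_ (sumBelow-cong m e) (e m)

sumBelow-suc : ∀ m (f : ℕ → ℕ) → sumBelow m (λ j → suc (f j)) ≡ m + sumBelow m f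
sumBelow-suc zero f = refl
sumBelow-suc (suc m) f rewrite sumBelow-suc m f = shuffle m (sumBelow m f) (f m)
  where
  shuffle : ∀ a b c → a + b + suc c ≡ suc (a + (b + c))
  shuffle = solve-∀

sumBelow-≤ : ∀ m (f : ℕ → ℕ) → (∀ j → f j ≤ 1) → sumBelow m f ≤ m
sumBelow-≤ zero f f≤1 = z≤n
sumBelow-≤ (suc m) f f≤1 =
  subst (sumBelow m f + f m ≤_) (+-comm m 1) (+-mono-≤ (sumBelow-≤ m f f≤1) (f≤1 m))

head≤sumBelow : ∀ m (f : ℕ → ℕ) → f 0 ≤ sumBelow (suc m) f
head≤sumBelow zero f = ≤-refl
head≤sumBelow (suc m) f = ≤-trans (head≤sumBelow m f) (m≤m+n _ _)

sumBelow-pairs : ∀ m (h : ℕ → ℕ) →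
  sumBelow (m + m) h ≡ sumBelow m (λ j → h (j + j) + h (suc (j + j)))
sumBelow-pairs zero h = refl
sumBelow-pairs (suc m) h rewrite +-suc m m | sumBelow-pairs m h =
  +-assoc (sumBelow m (λ j → h (j + j) + h (suc (j + j)))) (h (m + m)) (h (suc (m + m)))

sumBelow-rotate : ∀ m (h : ℕ → ℕ) → h m ≡ h 0 → sumBelow m (λ j → h (suc j)) ≡ sumBelow m h
sumBelow-rotate m h hm≡h0 = +-cancelʳ-≡ _ _ _ (trans (rotated m) (cong (sumBelow m h +_) hm≡h0))
  where
  shuffle : ∀ a b c → a + b + c ≡ a + c + b
  shuffle = solve-∀
  rotated : ∀ k → sumBelow k (λ j → h (suc j)) + h 0 ≡ sumBelow k h + h k
  rotated zero = refl
  rotated (suc k) = trans (shuffle (sumBelow k (λ j → h (suc j))) (h (suc k)) (h 0))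
                          (cong (_+ h (suc k)) (rotated k))

module Arcs {n : ℕ} {C : Ternary n} (CO : IsCircularOrdering C) where
  open IsCircularOrdering CO using (cyclic; asym) renaming (trans to C-trans)
  open CircularOrder CO

  -- arc a b x is 1 if x lies on the half-open arc (a, b] and 0 otherwise.
  arc : Fin n → Fin n → Fin n → ℕ
  arc a b x = indicator (x ≟ b) + indicator (C? a x b)

  arc≤1 : ∀ a b x → arc a b x ≤ 1
  arc≤1 a b x with x ≟ b | C? a x b
  ... | yes refl | yes h = ⊥-elim (¬C-xyy h)
  ... | yes _ | no _ = s≤s z≤n
  ... | no _ | yes _ = s≤s z≤n
  ... | no _ | no _ = z≤n

  arc-end : ∀ a b → arc a b b ≡ 1
  arc-end a b rewrite indicator-yes (b ≟ b) refl | indicator-no (C? a b b) ¬C-xyy = refl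

  arc-concat : ∀ {a b c} → C a b c → ∀ x → arc a b x + arc b c x ≡ arc a c x
  arc-concat {a} {b} {c} abc x with x ≟ a
  ... | yes refl
    rewrite indicator-no (x ≟ b) (C⇒≢₁₂ abc) | indicator-no (C? x x b) ¬C-xxy
          | indicator-no (x ≟ c) (C⇒≢₁₃ abc) | indicator-no (C? b x c) (asym (cyclic abc))
          | indicator-no (C? x x c) ¬C-xxy = refl
  ... | no x≢a with x ≟ b
  ...   | yes refl
    rewrite indicator-no (C? a x x) ¬C-xyy | indicator-no (x ≟ c) (C⇒≢₂₃ abc)
          | indicator-no (C? x x c) ¬C-xxy | indicator-yes (C? a x c) abc = refl
  ...   | no x≢b with x ≟ c
  ...     | yes refl
    rewrite indicator-no (C? a x b) (asym abc) | indicator-no (C? b x x) ¬C-xyy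
          | indicator-no (C? a x x) ¬C-xyy = refl
  ...     | no x≢c with C? a x b
  ...       | yes axb
    rewrite indicator-no (C? b x c) (asym (cyclic (chain axb abc)))
          | indicator-yes (C? a x c) (C-trans axb abc) = refl
  ...       | no ¬axb with C? a x c
  ...         | yes axc
    rewrite indicator-yes (C? b x c) (chain (flip (≢-sym x≢a) x≢b (C⇒≢₁₂ abc) ¬axb) axc) = refl
  ...         | no ¬axc
    rewrite indicator-no (C? b x c)
              (asym (chain abc (flip (≢-sym x≢a) x≢c (C⇒≢₁₃ abc) ¬axc))) = refl

  arc-wrap : ∀ {a b c} → C a c b → ∀ x → arc a b x + arc b c x ≡ suc (arc a c x)
  arc-wrap {a} {b} {c} acb x with x ≟ a
  ... | yes refl
    rewrite indicator-no (x ≟ b) (C⇒≢₁₃ acb) | indicator-no (C? x x b) ¬C-xxy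
          | indicator-no (x ≟ c) (C⇒≢₁₂ acb) | indicator-yes (C? b x c) (rotate² acb)
          | indicator-no (C? x x c) ¬C-xxy = refl
  ... | no x≢a with x ≟ b
  ...   | yes refl
    rewrite indicator-no (C? a x x) ¬C-xyy | indicator-no (x ≟ c) (≢-sym (C⇒≢₂₃ acb))
          | indicator-no (C? x x c) ¬C-xxy | indicator-no (C? a x c) (asym acb) = refl
  ...   | no x≢b with x ≟ c
  ...     | yes refl
    rewrite indicator-yes (C? a x b) acb | indicator-no (C? b x x) ¬C-xyy
          | indicator-no (C? a x x) ¬C-xyy = refl
  ...     | no x≢c with C? a x c
  ...       | yes axc
    rewrite indicator-yes (C? a x b) (C-trans axc acb)
          | indicator-yes (C? b x c) (rotate² (chain axc acb)) = refl
  ...       | no ¬axc with C? a x b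
  ...         | yes axb
    rewrite indicator-no (C? b x c)
              (asym (rotate² (chain (flip (≢-sym x≢a) x≢c (C⇒≢₁₂ acb) ¬axc) axb))) = refl
  ...         | no ¬axb
    rewrite indicator-yes (C? b x c)
              (cyclic (chain acb (flip (≢-sym x≢a) x≢b (C⇒≢₁₃ acb) ¬axb))) = refl

record ClosedWalk {n : ℕ} (G : Graph n) (m : ℕ) : Set where
  open Graph G
  field
    vertex    : ℕ → Fin n
    periodic  : ∀ i → vertex (i + m) ≡ vertex i
    adjacent  : ∀ i → Adj (vertex i) (vertex (suc i))
    distinct₂ : ∀ i → vertex i ≢ vertex (2 + i)
    distinct₃ : ∀ i → vertex i ≢ vertex (3 + i)

  orientation : ℕ → Ternary n → Set
  orientation i C = C (vertex i) (vertex (1 + i)) (vertex (2 + i))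

  distinct₁ : ∀ i → vertex i ≢ vertex (1 + i)
  distinct₁ i e = Graph.irrefl G (subst (λ v → Adj v (vertex (suc i))) e (adjacent i))

ClosedWalk-tail : ∀ {n} {G : Graph n} {m} → ClosedWalk G m → ClosedWalk G m
ClosedWalk-tail W = record
  { vertex    = λ i → vertex (suc i)
  ; periodic  = λ i → periodic (suc i)
  ; adjacent  = λ i → adjacent (suc i)
  ; distinct₂ = λ i → distinct₂ (suc i)
  ; distinct₃ = λ i → distinct₃ (suc i)
  }
  where open ClosedWalk W

module _ {n : ℕ} {G : Graph n} {C : Ternary n} (CO : IsCircularOrdering C) (alt : PathAlternating G C) where
  open IsCircularOrdering CO using (asym)
  open CircularOrder CO
  open Arcs CO

  module _ {m : ℕ} (W : ClosedWalk G m) where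
    open ClosedWalk W

    orientation-alternates : ∀ i → ExactlyOne (orientation i C) (orientation (suc i) C)
    orientation-alternates i =
      alt (vertex i) (vertex (1 + i)) (vertex (2 + i)) (vertex (3 + i))
          (distinct₁ i , distinct₂ i , distinct₃ i ,
           distinct₁ (1 + i) , distinct₂ (1 + i) , distinct₁ (2 + i))
          (adjacent i) (adjacent (1 + i)) (adjacent (2 + i))

    orientation-parity : orientation 0 C → ∀ j → orientation (j + j) C × ¬ orientation (suc (j + j)) C
    orientation-parity o₀ zero = o₀ , proj₁ (orientation-alternates 0) o₀
    orientation-parity o₀ (suc j) rewrite +-suc j j =
      oₑ , proj₁ (orientation-alternates (2 + (j + j))) oₑ
      where oₑ = proj₂ (orientation-alternates (suc (j + j))) (proj₂ (orientation-parity o₀ j))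

  -- Count how often the walk, run twice around, steps onto x = vertex 3, i.e. the sum T of
  -- arc (vertex t) (vertex (1 + t)) x over t < 2m.  Grouping the steps as (0,1), (2,3), …
  -- each counterclockwise pair merges into a single arc, so T ≤ m; grouping them as
  -- (1,2), (3,4), … each clockwise pair wraps once around the circle, so
  -- T ≥ m + arc (vertex 1) (vertex 3) x = m + 1.
  noCounterclockwiseStart : ∀ {k} (W : ClosedWalk G (suc k)) → ClosedWalk.orientation W 0 C → ⊥
  noCounterclockwiseStart {k} W o₀ = 1+n≰n (≤-trans lower upper)
    where
    open ClosedWalk W
    m = suc k
    x = vertex 3
    step : ℕ → ℕ
    step t = arc (vertex t) (vertex (suc t)) x
    evenArc oddArc : ℕ → ℕ
    evenArc j = arc (vertex (j + j)) (vertex (2 + (j + j))) x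
    oddArc j = arc (vertex (1 + (j + j))) (vertex (3 + (j + j))) x
    parity = orientation-parity W o₀

    upper : sumBelow (m + m) step ≤ m
    upper = subst (_≤ m) (sym (trans (sumBelow-pairs m step) (sumBelow-cong m merge)))
                  (sumBelow-≤ m evenArc (λ j → arc≤1 _ _ x))
      where
      merge : ∀ j → step (j + j) + step (suc (j + j)) ≡ evenArc j
      merge j = arc-concat (proj₁ (parity j)) x

    lower : suc m ≤ sumBelow (m + m) step
    lower = subst (suc m ≤_) (sym total)
              (subst (_≤ m + sumBelow m oddArc) (+-comm m 1)
                     (+-monoʳ-≤ m (subst (_≤ sumBelow m oddArc) (arc-end (vertex 1) x)
                                         (head≤sumBelow k oddArc))))
      where
      wrap : ∀ j → step (suc (j + j)) + step (2 + (j + j)) ≡ suc (oddArc j)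
      wrap j = arc-wrap (flip (distinct₁ (1 + (j + j))) (distinct₁ (2 + (j + j))) (distinct₂ (1 + (j + j)))
                              (proj₂ (parity j))) x
      step-periodic : step (m + m) ≡ step 0
      step-periodic = cong₂ (λ a b → arc a b x) (trans (periodic m) (periodic 0))
                                                (trans (periodic (suc m)) (periodic 1))
      total : sumBelow (m + m) step ≡ m + sumBelow m oddArc
      total = begin
        sumBelow (m + m) step                      ≡⟨ sumBelow-rotate (m + m) step step-periodic ⟨
        sumBelow (m + m) (λ t → step (suc t))      ≡⟨ sumBelow-pairs m (λ t → step (suc t)) ⟩
        sumBelow m (λ j → step (suc (j + j)) + step (2 + (j + j))) ≡⟨ sumBelow-cong m wrap ⟩
        sumBelow m (λ j → suc (oddArc j))          ≡⟨ sumBelow-suc m oddArc ⟩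
        m + sumBelow m oddArc                      ∎
        where open ≡-Reasoning

  noClosedWalk : ∀ {k} → ¬ ClosedWalk G (suc k)
  noClosedWalk W with C? (vertex 0) (vertex 1) (vertex 2)
    where open ClosedWalk W
  ... | yes o₀ = noCounterclockwiseStart W o₀
  ... | no ¬o₀ = noCounterclockwiseStart (ClosedWalk-tail W) (proj₂ (orientation-alternates W 0) ¬o₀)

shift-mod-≢ : ∀ {m} .{{_ : NonZero m}} {d r} → 0 < d → d < m → r < m → (d + r) % m ≢ r
shift-mod-≢ {m} {d} {r} 0<d d<m r<m with <-≤-connex (d + r) m
... | inj₁ d+r<m = λ e → <-irrefl (sym (+-cancelʳ-≡ r d 0 (trans (sym (m<n⇒m%n≡m d+r<m)) e))) 0<d
... | inj₂ m≤d+r = λ e → <-irrefl (d≡m e) d<m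
  where
  s = d + r ∸ m
  s+m≡d+r : s + m ≡ d + r
  s+m≡d+r = m∸n+n≡m m≤d+r
  d+r%m≡s : (d + r) % m ≡ s
  d+r%m≡s = trans (cong (_% m) (sym s+m≡d+r))
                  (trans ([m+n]%n≡m%n s m) (m<n⇒m%n≡m (m<n+o⇒m∸n<o (d + r) m (+-mono-< d<m r<m))))
  d≡m : (d + r) % m ≡ r → d ≡ m
  d≡m e = +-cancelʳ-≡ r d m
            (trans (sym s+m≡d+r) (trans (cong (_+ m) (trans (sym d+r%m≡s) e)) (+-comm r m)))

mod-≢ : ∀ m .{{_ : NonZero m}} d i → 0 < d → d < m → (d + i) % m ≢ i % m
mod-≢ m d i 0<d d<m e = shift-mod-≢ 0<d d<m (m%n<n i m) (trans (sym reduce) e)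
  where
  reduce : (d + i) % m ≡ (d + i % m) % m
  reduce = trans (%-distribˡ-+ d i m) (cong (λ t → (t + i % m) % m) (m<n⇒m%n≡m d<m))

suc-% : ∀ m .{{_ : NonZero m}} i → suc i % m ≡ suc (i % m) % m
suc-% m i = trans (%-distribˡ-+ 1 i m)
                  (sym (trans (%-distribˡ-+ 1 (i % m) m) (cong (λ t → (1 % m + t) % m) (m%n%n≡m%n i m))))

suc-mod : ∀ m .{{_ : NonZero m}} i →
  (suc (i % m) < m × suc i % m ≡ suc (i % m)) ⊎ (suc (i % m) ≡ m × suc i % m ≡ 0)
suc-mod m i with m≤n⇒m<n∨m≡n (m%n<n i m)
... | inj₁ lt = inj₁ (lt , trans (suc-% m i) (m<n⇒m%n≡m lt))
... | inj₂ eq = inj₂ (eq , trans (suc-% m i) (trans (cong (_% m) eq) (n%n≡0 m)))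

module _ {n : ℕ} (G : Graph n) where
  open Graph G renaming (sym to adj-sym)

  cycle⇒closedWalk : ∀ k (f : Fin (4 + k) → Fin n) → Injective _≡_ _≡_ f →
    (∀ i → Adj (f (inject₁ i)) (f (suc i))) → Adj (f (fromℕ (3 + k))) (f zero) →
    ClosedWalk G (4 + k)
  cycle⇒closedWalk k f inj adj closing = record
    { vertex    = vertex
    ; periodic  = λ i → f-cong (trans (toℕ-at (i + m)) (trans ([m+n]%n≡m%n i m) (sym (toℕ-at i))))
    ; adjacent  = adjacent
    ; distinct₂ = distinct 2 (s≤s z≤n) (s≤s (s≤s (s≤s z≤n)))
    ; distinct₃ = distinct 3 (s≤s z≤n) (s≤s (s≤s (s≤s (s≤s z≤n))))
    }
    where
    m = 4 + k
    at : ℕ → Fin m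
    at i = fromℕ< (m%n<n i m)
    toℕ-at : ∀ i → toℕ (at i) ≡ i % m
    toℕ-at i = toℕ-fromℕ< (m%n<n i m)
    vertex : ℕ → Fin n
    vertex i = f (at i)
    f-cong : ∀ {a b} → toℕ a ≡ toℕ b → f a ≡ f b
    f-cong e = cong f (toℕ-injective e)
    distinct : ∀ d → 0 < d → d < m → ∀ i → vertex i ≢ vertex (d + i)
    distinct d 0<d d<m i e =
      mod-≢ m d i 0<d d<m (trans (sym (toℕ-at (d + i))) (trans (cong toℕ (sym (inj e))) (toℕ-at i)))
    adjacent : ∀ i → Adj (vertex i) (vertex (suc i))
    adjacent i with suc-mod m i
    ... | inj₁ (lt , e) =
      subst₂ Adj (f-cong (trans (toℕ-inject₁ j) (trans (toℕ-fromℕ< _) (sym (toℕ-at i)))))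
                 (f-cong (trans (cong suc (toℕ-fromℕ< _)) (trans (sym e) (sym (toℕ-at (suc i))))))
                 (adj j)
      where j = fromℕ< (s≤s⁻¹ lt)
    ... | inj₂ (eq , e) =
      subst₂ Adj (f-cong (trans (toℕ-fromℕ _) (trans (suc-injective (sym eq)) (sym (toℕ-at i)))))
                 (f-cong (sym (trans (toℕ-at (suc i)) e)))
                 closing

  module _ {C : Ternary n} (CO : IsCircularOrdering C) where

    noCycle : PathAlternating G C → (∀ x y z → ¬ Triangle G x y z) → ¬ HasCycle G
    noCycle alt noTriangle (zero , f , _ , adj , closing) =
      noTriangle _ _ _ (adj zero , adj (suc zero) , adj-sym closing)
    noCycle alt noTriangle (suc k , f , inj , adj , closing) =
      noClosedWalk CO alt (cycle⇒closedWalk k f inj adj closing)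

    cfFree⇒caterpillarForest : IsCFFree G C → IsCaterpillarForest G
    cfFree⇒caterpillarForest cf = noCycle alt (proj₁ cf) , noSubdividedClaw G CO alt
      where alt = cfFree⇒pathAlternating G CO cf

-- Forests and removable vertices

AtMostOne : ∀ {n} → (Fin n → Set) → Set
AtMostOne P = ∀ {y y′} → P y → P y′ → y ≡ y′

unique-or-another : ∀ {n} {P : Fin n → Set} → (∀ y → Dec (P y)) → ∀ w →
  (∀ y → P y → y ≡ w) ⊎ ∃ λ y → P y × y ≢ w
unique-or-another {P = P} P? w with any? (λ y → P? y ×-dec ¬? (y ≟ w))
... | yes (y , py , y≢w) = inj₂ (y , py , y≢w)
... | no none = inj₁ only
  where
  only : ∀ y → P y → y ≡ w
  only y py with y ≟ w
  ... | yes y≡w = y≡w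
  ... | no y≢w = ⊥-elim (none (y , py , y≢w))

atMostOne-or-two : ∀ {n} {P : Fin n → Set} → (∀ y → Dec (P y)) →
  AtMostOne P ⊎ Σ (Fin n) λ y → Σ (Fin n) λ y′ → P y × P y′ × y ≢ y′
atMostOne-or-two P? with any? P?
... | no none = inj₁ (λ py _ → ⊥-elim (none (_ , py)))
... | yes (w , pw) with unique-or-another P? w
...   | inj₁ only = inj₁ (λ py py′ → trans (only _ py) (sym (only _ py′)))
...   | inj₂ (y , py , y≢w) = inj₂ (y , w , py , pw , y≢w)

∷-injective : ∀ {n k} {x : Fin n} {f : Fin k → Fin n} →
  (∀ i → f i ≢ x) → Injective _≡_ _≡_ f → Injective _≡_ _≡_ (x ∷ f)
∷-injective x∉f f-inj {zero} {zero} _ = refl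
∷-injective x∉f f-inj {zero} {suc j} e = ⊥-elim (x∉f j (sym e))
∷-injective x∉f f-inj {suc i} {zero} e = ⊥-elim (x∉f i e)
∷-injective x∉f f-inj {suc i} {suc j} e = cong suc (f-inj e)

[]-injective : ∀ {n} → Injective _≡_ _≡_ ([] {A = Fin n})
[]-injective {x = ()}

module _ {n : ℕ} (G : Graph n) where
  open Graph G renaming (sym to adj-sym)

  adj⇒≢ : ∀ {x y} → Adj x y → x ≢ y
  adj⇒≢ xy refl = irrefl xy

  triangle⇒cycle : ∀ {a b c} → Adj a b → Adj b c → Adj c a → HasCycle G
  triangle⇒cycle {a} {b} {c} ab bc ca = 0 , a ∷ b ∷ c ∷ [] , injective , adjacent , ca
    where
    injective : Injective _≡_ _≡_ (a ∷ b ∷ c ∷ [])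
    injective = ∷-injective (λ { zero → ≢-sym (adj⇒≢ ab) ; (suc zero) → adj⇒≢ ca })
               (∷-injective (λ { zero → ≢-sym (adj⇒≢ bc) }) (∷-injective (λ ()) []-injective))
    adjacent : ∀ i → Adj ((a ∷ b ∷ c ∷ []) (inject₁ i)) ((a ∷ b ∷ c ∷ []) (suc i))
    adjacent zero = ab
    adjacent (suc zero) = bc

  square⇒cycle : ∀ {a b c d} → a ≢ c → b ≢ d → Adj a b → Adj b c → Adj c d → Adj d a → HasCycle G
  square⇒cycle {a} {b} {c} {d} a≢c b≢d ab bc cd da =
    1 , a ∷ b ∷ c ∷ d ∷ [] , injective , adjacent , da
    where
    injective : Injective _≡_ _≡_ (a ∷ b ∷ c ∷ d ∷ [])
    injective =
      ∷-injective (λ { zero → ≢-sym (adj⇒≢ ab) ; (suc zero) → ≢-sym a≢c ; (suc (suc zero)) → adj⇒≢ da })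
      (∷-injective (λ { zero → ≢-sym (adj⇒≢ bc) ; (suc zero) → ≢-sym b≢d })
      (∷-injective (λ { zero → ≢-sym (adj⇒≢ cd) }) (∷-injective (λ ()) []-injective)))
    adjacent : ∀ i → Adj ((a ∷ b ∷ c ∷ d ∷ []) (inject₁ i)) ((a ∷ b ∷ c ∷ d ∷ []) (suc i))
    adjacent zero = ab
    adjacent (suc zero) = bc
    adjacent (suc (suc zero)) = cd

  forest⇒triangleFree : IsForest G → ∀ x y z → ¬ Triangle G x y z
  forest⇒triangleFree forest x y z (xy , yz , xz) = forest (triangle⇒cycle xy yz (adj-sym xz))

  forest⇒squareFree : IsForest G → ∀ a b c d → ¬ Induced4Cycle G a b c d
  forest⇒squareFree forest a b c d ((_ , a≢c , _ , _ , b≢d , _) , ab , bc , cd , da , _) =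
    forest (square⇒cycle a≢c b≢d ab bc cd da)

  record Path (L : ℕ) : Set where
    field
      vertex    : ℕ → Fin n
      adjacent  : ∀ {i} → i < L → Adj (vertex i) (vertex (suc i))
      injective : ∀ {i j} → i ≤ L → j ≤ L → vertex i ≡ vertex j → i ≡ j

    OnPath : Fin n → Set
    OnPath y = ∃ λ (t : Fin (suc L)) → vertex (toℕ t) ≡ y

    onPath? : ∀ y → Dec (OnPath y)
    onPath? y = any? (λ t → vertex (toℕ t) ≟ y)

  Path-prepend : ∀ {L} (P : Path L) y → Adj y (Path.vertex P 0) → ¬ Path.OnPath P y → Path (suc L)
  Path-prepend {L} P y y~P y∉P =
    record { vertex = vertex′ ; adjacent = adjacent′ ; injective = injective′ }
    where
    open Path P
    vertex′ : ℕ → Fin n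
    vertex′ zero = y
    vertex′ (suc i) = vertex i
    adjacent′ : ∀ {i} → i < suc L → Adj (vertex′ i) (vertex′ (suc i))
    adjacent′ {zero} _ = y~P
    adjacent′ {suc i} i<L = adjacent (s≤s⁻¹ i<L)
    injective′ : ∀ {i j} → i ≤ suc L → j ≤ suc L → vertex′ i ≡ vertex′ j → i ≡ j
    injective′ {zero} {zero} _ _ _ = refl
    injective′ {zero} {suc j} _ j≤L e =
      ⊥-elim (y∉P (fromℕ< j≤L , trans (cong vertex (toℕ-fromℕ< _)) (sym e)))
    injective′ {suc i} {zero} i≤L _ e =
      ⊥-elim (y∉P (fromℕ< i≤L , trans (cong vertex (toℕ-fromℕ< _)) e))
    injective′ {suc i} {suc j} i≤L j≤L e = cong suc (injective (s≤s⁻¹ i≤L) (s≤s⁻¹ j≤L) e)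

  Path-chord⇒cycle : ∀ {L} (P : Path L) j → 2 + j ≤ L →
    Adj (Path.vertex P 0) (Path.vertex P (2 + j)) → HasCycle G
  Path-chord⇒cycle {L} P j 2+j≤L chord = j , f , f-injective , f-adjacent , closing
    where
    open Path P
    f : Fin (3 + j) → Fin n
    f t = vertex (toℕ t)
    toℕ≤L : ∀ (t : Fin (3 + j)) → toℕ t ≤ L
    toℕ≤L t = ≤-trans (s≤s⁻¹ (toℕ<n t)) 2+j≤L
    f-injective : Injective _≡_ _≡_ f
    f-injective {s} {t} e = toℕ-injective (injective (toℕ≤L s) (toℕ≤L t) e)
    f-adjacent : ∀ t → Adj (f (inject₁ t)) (f (suc t))
    f-adjacent t = subst (λ i → Adj (vertex i) (vertex (suc (toℕ t)))) (sym (toℕ-inject₁ t))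
                         (adjacent (≤-trans (toℕ<n t) 2+j≤L))
    closing : Adj (f (fromℕ (2 + j))) (f zero)
    closing = subst (λ i → Adj (vertex i) (vertex 0)) (sym (toℕ-fromℕ (2 + j))) (adj-sym chord)

  -- In a forest, a path that cannot be extended at its start has at most one neighbour
  -- there: every neighbour lies on the path, and any but the next vertex closes a cycle.
  Path-end-atMostOneNeighbour : IsForest G → ∀ {L} (P : Path L) →
    (∀ y → Adj (Path.vertex P 0) y → Path.OnPath P y) → AtMostOne (Adj (Path.vertex P 0))
  Path-end-atMostOneNeighbour forest {L} P closed e e′ =
    trans (next _ (closed _ e) e) (sym (next _ (closed _ e′) e′))
    where
    open Path P
    next : ∀ y → OnPath y → Adj (vertex 0) y → y ≡ vertex 1
    next y (t , refl) e with toℕ t | toℕ<n t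
    ... | zero | _ = ⊥-elim (irrefl e)
    ... | suc zero | _ = refl
    ... | suc (suc j) | j<L = ⊥-elim (forest (Path-chord⇒cycle P j (s≤s⁻¹ j<L) e))

  forest⇒atMostOneNeighbour : IsForest G → Fin n → ∃ λ l → AtMostOne (Adj l)
  forest⇒atMostOneNeighbour forest v = extend n 0 (subst (n ≤_) (sym (+-identityʳ n)) ≤-refl) trivial
    where
    trivial : Path 0
    trivial = record { vertex = λ _ → v ; adjacent = λ () ; injective = λ { z≤n z≤n _ → refl } }
    extend : ∀ fuel L → n ≤ fuel + L → Path L → ∃ λ l → AtMostOne (Adj l)
    extend zero L n≤L P with pigeonhole (s≤s n≤L) (λ t → Path.vertex P (toℕ t))
    ... | s , t , s<t , e =
      ⊥-elim (<-irrefl (Path.injective P (s≤s⁻¹ (toℕ<n s)) (s≤s⁻¹ (toℕ<n t)) e) s<t)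
    extend (suc fuel) L n≤fuel+L P
      with any? (λ y → dec (Path.vertex P 0) y ×-dec ¬? (Path.onPath? P y))
    ... | yes (y , e , y∉P) =
      extend fuel (suc L) (subst (n ≤_) (sym (+-suc fuel L)) n≤fuel+L) (Path-prepend P y (adj-sym e) y∉P)
    ... | no noExtension = Path.vertex P 0 , Path-end-atMostOneNeighbour forest P closed
      where
      closed : ∀ y → Adj (Path.vertex P 0) y → Path.OnPath P y
      closed y e with Path.onPath? P y
      ... | yes y∈P = y∈P
      ... | no y∉P = ⊥-elim (noExtension (y , e , y∉P))

deleteVertex : ∀ {n} → Graph (suc n) → Fin (suc n) → Graph n
deleteVertex G r = record
  { Adj    = λ x y → Graph.Adj G (punchIn r x) (punchIn r y)
  ; sym    = Graph.sym G
  ; irrefl = Graph.irrefl G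
  ; dec    = λ x y → Graph.dec G (punchIn r x) (punchIn r y)
  }

caterpillarForest-deleteVertex : ∀ {n} (G : Graph (suc n)) r →
  IsCaterpillarForest G → IsCaterpillarForest (deleteVertex G r)
caterpillarForest-deleteVertex G r (acyclic , clawFree) =
  (λ (k , f , f-inj , adj , closing) → acyclic (k , punchIn r ∘ f , ι-inj f-inj , adj , closing)) ,
  (λ (f , f-inj , edges) → clawFree (punchIn r ∘ f , ι-inj f-inj , edges))
  where
  ι-inj : ∀ {k} {f : Fin k → Fin _} → Injective _≡_ _≡_ f → Injective _≡_ _≡_ (punchIn r ∘ f)
  ι-inj f-inj e = f-inj (punchIn-injective r _ _ e)

module _ {n : ℕ} (G : Graph n) where
  open Graph G renaming (sym to adj-sym)

  AnchorCondition : Fin n → Set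
  AnchorCondition u = ∀ w → Adj u w → (∀ x → Adj u x → x ≡ w) → AtMostOne (λ b → Adj w b × b ≢ u)

  -- The condition under which a leaf r with neighbour u can be inserted back into an
  -- alternating placement of G - r.
  RemovalCondition : Fin n → Fin n → Set
  RemovalCondition r u = ∀ w → Adj u w → w ≢ r → (∀ x → Adj u x → x ≢ r → x ≡ w) →
    AtMostOne (λ b → Adj w b × b ≢ u)

  Removable : Fin n → Set
  Removable r =
    (∀ y → ¬ Adj r y) ⊎ Σ (Fin n) λ u → Adj r u × (∀ y → Adj r y → y ≡ u) × RemovalCondition r u

  removalCondition-twoOthers : ∀ {r u x x′} → Adj u x → Adj u x′ → x ≢ r → x′ ≢ r → x ≢ x′ →
    RemovalCondition r u
  removalCondition-twoOthers ux ux′ x≢r x′≢r x≢x′ _ _ _ only =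
    ⊥-elim (x≢x′ (trans (only _ ux x≢r) (sym (only _ ux′ x′≢r))))

  Fork : Fin n → Fin n → Set
  Fork r u = Σ (Fin n) λ w → Adj u w × (∀ x → Adj u x → x ≢ r → x ≡ w) ×
             Σ (Fin n) λ b → Σ (Fin n) λ b′ → (Adj w b × b ≢ u) × (Adj w b′ × b′ ≢ u) × b ≢ b′

  removalCondition-or-fork : ∀ r u → RemovalCondition r u ⊎ Fork r u
  removalCondition-or-fork r u with any? (λ w → dec u w ×-dec ¬? (w ≟ r))
  ... | no none = inj₁ (λ w uw w≢r _ → ⊥-elim (none (w , uw , w≢r)))
  ... | yes (w , uw , w≢r) with unique-or-another (λ x → dec u x ×-dec ¬? (x ≟ r)) w
  ...   | inj₂ (x , (ux , x≢r) , x≢w) = inj₁ (removalCondition-twoOthers ux uw x≢r w≢r x≢w)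
  ...   | inj₁ only with atMostOne-or-two (λ b → dec w b ×-dec ¬? (b ≟ u))
  ...     | inj₁ atMostOne = inj₁ cond
    where
    cond : RemovalCondition r u
    cond w′ uw′ w′≢r _ rewrite only w′ (uw′ , w′≢r) = atMostOne
  ...     | inj₂ (b , b′ , wb , wb′ , b≢b′) =
    inj₂ (w , uw , (λ x ux x≢r → only x (ux , x≢r)) , b , b′ , wb , wb′ , b≢b′)

  forkWithLongLegs⇒subdividedClaw : IsForest G → ∀ {l u w b b′ b₂ b₂′} →
    AtMostOne (Adj l) → Adj l u → Adj u w → (∀ x → Adj u x → x ≢ l → x ≡ w) →
    Adj w b → b ≢ u → Adj w b′ → b′ ≢ u → b ≢ b′ → Adj b b₂ → b₂ ≢ w → Adj b′ b₂′ → b₂′ ≢ w →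
    HasSubdividedClaw G
  forkWithLongLegs⇒subdividedClaw forest {l} {u} {w} {b} {b′} {b₂} {b₂′}
    l-atMostOne lu uw w-only wb b≢u wb′ b′≢u b≢b′ bb₂ b₂≢w b′b₂′ b₂′≢w =
    w ∷ u ∷ b ∷ b′ ∷ l ∷ b₂ ∷ b₂′ ∷ [] , claw-injective ,
    adj-sym uw , wb , wb′ , adj-sym lu , bb₂ , b′b₂′
    where
    triangle = forest⇒triangleFree G forest
    u≢w = adj⇒≢ G uw
    b≢l : b ≢ l
    b≢l refl = u≢w (sym (l-atMostOne (adj-sym wb) lu))
    b′≢l : b′ ≢ l
    b′≢l refl = u≢w (sym (l-atMostOne (adj-sym wb′) lu))
    l≢w : l ≢ w
    l≢w refl = b≢u (l-atMostOne wb lu)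
    b₂≢u : b₂ ≢ u
    b₂≢u refl = adj⇒≢ G wb (sym (w-only b (adj-sym bb₂) b≢l))
    b₂′≢u : b₂′ ≢ u
    b₂′≢u refl = adj⇒≢ G wb′ (sym (w-only b′ (adj-sym b′b₂′) b′≢l))
    b₂≢l : b₂ ≢ l
    b₂≢l refl = b≢u (l-atMostOne (adj-sym bb₂) lu)
    b₂′≢l : b₂′ ≢ l
    b₂′≢l refl = b′≢u (l-atMostOne (adj-sym b′b₂′) lu)
    b₂≢b′ : b₂ ≢ b′
    b₂≢b′ refl = triangle w b b′ (wb , bb₂ , wb′)
    b₂′≢b : b₂′ ≢ b
    b₂′≢b refl = triangle w b′ b (wb′ , b′b₂′ , wb)
    b₂′≢b₂ : b₂′ ≢ b₂
    b₂′≢b₂ refl = forest (square⇒cycle G (≢-sym b₂≢w) b≢b′ wb bb₂ (adj-sym b′b₂′) (adj-sym wb′))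
    claw-injective : Injective _≡_ _≡_ (w ∷ u ∷ b ∷ b′ ∷ l ∷ b₂ ∷ b₂′ ∷ [])
    claw-injective =
      ∷-injective (λ { zero → u≢w ; (suc zero) → ≢-sym (adj⇒≢ G wb)
                     ; (suc (suc zero)) → ≢-sym (adj⇒≢ G wb′)
                     ; (suc (suc (suc zero))) → l≢w ; (suc (suc (suc (suc zero)))) → b₂≢w
                     ; (suc (suc (suc (suc (suc zero))))) → b₂′≢w })
      (∷-injective (λ { zero → b≢u ; (suc zero) → b′≢u ; (suc (suc zero)) → adj⇒≢ G lu
                      ; (suc (suc (suc zero))) → b₂≢u ; (suc (suc (suc (suc zero)))) → b₂′≢u })
      (∷-injective (λ { zero → ≢-sym b≢b′ ; (suc zero) → ≢-sym b≢l
                      ; (suc (suc zero)) → ≢-sym (adj⇒≢ G bb₂)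
                      ; (suc (suc (suc zero))) → b₂′≢b })
      (∷-injective (λ { zero → ≢-sym b′≢l ; (suc zero) → b₂≢b′
                      ; (suc (suc zero)) → ≢-sym (adj⇒≢ G b′b₂′) })
      (∷-injective (λ { zero → b₂≢l ; (suc zero) → b₂′≢l })
      (∷-injective (λ { zero → b₂′≢b₂ }) (∷-injective (λ ()) []-injective))))))


  -- Start from a vertex l with at most one neighbour u.  Unless l itself is removable, u
  -- continues to a unique w with two further neighbours b, b′; one of them is a leaf (and
  -- removable, as w has two other neighbours), or w is the centre of a subdivided claw.
  findRemovable : IsCaterpillarForest G → Fin n → ∃ Removable
  findRemovable (forest , noClaw) v with forest⇒atMostOneNeighbour G forest v
  ... | l , l-atMostOne with any? (dec l)
  ...   | no isolated = l , inj₁ (λ y ly → isolated (y , ly))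
  ...   | yes (u , lu) with removalCondition-or-fork l u
  ...     | inj₁ cond = l , inj₂ (u , lu , (λ y ly → l-atMostOne ly lu) , cond)
  ...     | inj₂ (w , uw , w-only , b , b′ , (wb , b≢u) , (wb′ , b′≢u) , b≢b′)
    with unique-or-another (dec b) w | unique-or-another (dec b′) w
  ... | inj₁ b-leaf | _ =
    b , inj₂ (w , adj-sym wb , b-leaf ,
              removalCondition-twoOthers (adj-sym uw) wb′ (≢-sym b≢u) (≢-sym b≢b′) (≢-sym b′≢u))
  ... | inj₂ _ | inj₁ b′-leaf =
    b′ , inj₂ (w , adj-sym wb′ , b′-leaf ,
               removalCondition-twoOthers (adj-sym uw) wb (≢-sym b′≢u) b≢b′ (≢-sym b≢u))
  ... | inj₂ (b₂ , bb₂ , b₂≢w) | inj₂ (b₂′ , b′b₂′ , b₂′≢w) =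
    ⊥-elim (noClaw (forkWithLongLegs⇒subdividedClaw forest l-atMostOne lu uw w-only
                      wb b≢u wb′ b′≢u b≢b′ bb₂ b₂≢w b′b₂′ b₂′≢w))

-- Placements on ℕ and reinsertion of a vertex

Cyc : ℕ → ℕ → ℕ → Set
Cyc a b c = (a < b × b < c) ⊎ (b < c × c < a) ⊎ (c < a × a < b)

Cyc-cyclic : ∀ {a b c} → Cyc a b c → Cyc b c a
Cyc-cyclic (inj₁ p) = inj₂ (inj₂ p)
Cyc-cyclic (inj₂ (inj₁ p)) = inj₁ p
Cyc-cyclic (inj₂ (inj₂ p)) = inj₂ (inj₁ p)

Cyc-asym : ∀ {a b c} → Cyc a b c → ¬ Cyc a c b
Cyc-asym (inj₁ (_ , b<c)) (inj₁ (_ , c<b)) = <-asym b<c c<b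
Cyc-asym (inj₁ (_ , b<c)) (inj₂ (inj₁ (c<b , _))) = <-asym b<c c<b
Cyc-asym (inj₁ (a<b , _)) (inj₂ (inj₂ (b<a , _))) = <-asym a<b b<a
Cyc-asym (inj₂ (inj₁ (b<c , _))) (inj₁ (_ , c<b)) = <-asym b<c c<b
Cyc-asym (inj₂ (inj₁ (b<c , _))) (inj₂ (inj₁ (c<b , _))) = <-asym b<c c<b
Cyc-asym (inj₂ (inj₁ (_ , c<a))) (inj₂ (inj₂ (_ , a<c))) = <-asym c<a a<c
Cyc-asym (inj₂ (inj₂ (c<a , _))) (inj₁ (a<c , _)) = <-asym c<a a<c
Cyc-asym (inj₂ (inj₂ (_ , a<b))) (inj₂ (inj₁ (_ , b<a))) = <-asym a<b b<a
Cyc-asym (inj₂ (inj₂ (_ , a<b))) (inj₂ (inj₂ (b<a , _))) = <-asym a<b b<a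

Cyc-trans : ∀ {x y z w} → Cyc x y z → Cyc x z w → Cyc x y w
Cyc-trans (inj₁ (x<y , y<z)) (inj₁ (_ , z<w)) = inj₁ (x<y , <-trans y<z z<w)
Cyc-trans (inj₁ (x<y , y<z)) (inj₂ (inj₁ (z<w , w<x))) =
  ⊥-elim (<-asym (<-trans x<y y<z) (<-trans z<w w<x))
Cyc-trans (inj₁ (x<y , _)) (inj₂ (inj₂ (w<x , _))) = inj₂ (inj₂ (w<x , x<y))
Cyc-trans (inj₂ (inj₁ (_ , z<x))) (inj₁ (x<z , _)) = ⊥-elim (<-asym z<x x<z)
Cyc-trans (inj₂ (inj₁ (y<z , _))) (inj₂ (inj₁ (z<w , w<x))) = inj₂ (inj₁ (<-trans y<z z<w , w<x))
Cyc-trans (inj₂ (inj₁ (_ , z<x))) (inj₂ (inj₂ (_ , x<z))) = ⊥-elim (<-asym z<x x<z)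
Cyc-trans (inj₂ (inj₂ (z<x , _))) (inj₁ (x<z , _)) = ⊥-elim (<-asym z<x x<z)
Cyc-trans (inj₂ (inj₂ (_ , x<y))) (inj₂ (inj₁ (_ , w<x))) = inj₂ (inj₂ (w<x , x<y))
Cyc-trans (inj₂ (inj₂ (z<x , _))) (inj₂ (inj₂ (_ , x<z))) = ⊥-elim (<-asym z<x x<z)

Cyc-total : ∀ {a b c} → a ≢ b → b ≢ c → a ≢ c → Cyc a b c ⊎ Cyc a c b
Cyc-total {a} {b} {c} a≢b b≢c a≢c with <-cmp a b | <-cmp b c | <-cmp a c
... | tri≈ _ a≡b _ | _ | _ = ⊥-elim (a≢b a≡b)
... | _ | tri≈ _ b≡c _ | _ = ⊥-elim (b≢c b≡c)
... | _ | _ | tri≈ _ a≡c _ = ⊥-elim (a≢c a≡c)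
... | tri< a<b _ _ | tri< b<c _ _ | _ = inj₁ (inj₁ (a<b , b<c))
... | tri< _ _ _ | tri> _ _ c<b | tri< a<c _ _ = inj₂ (inj₁ (a<c , c<b))
... | tri< a<b _ _ | tri> _ _ _ | tri> _ _ c<a = inj₁ (inj₂ (inj₂ (c<a , a<b)))
... | tri> _ _ b<a | tri< _ _ _ | tri< a<c _ _ = inj₂ (inj₂ (inj₂ (b<a , a<c)))
... | tri> _ _ _ | tri< b<c _ _ | tri> _ _ c<a = inj₁ (inj₂ (inj₁ (b<c , c<a)))
... | tri> _ _ b<a | tri> _ _ c<b | tri< a<c _ _ = ⊥-elim (<-asym a<c (<-trans c<b b<a))
... | tri> _ _ b<a | tri> _ _ c<b | tri> _ _ _ = inj₂ (inj₂ (inj₁ (c<b , b<a)))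

positional : ∀ {n} → (Fin n → ℕ) → Ternary n
positional p x y z = Cyc (p x) (p y) (p z)

positional-isCircularOrdering : ∀ {n} (p : Fin n → ℕ) → Injective _≡_ _≡_ p →
  IsCircularOrdering (positional p)
positional-isCircularOrdering p p-inj = record
  { cyclic = Cyc-cyclic
  ; asym   = Cyc-asym
  ; trans  = Cyc-trans
  ; total  = λ x≢y y≢z x≢z →
      Cyc-total (λ e → x≢y (p-inj e)) (λ e → y≢z (p-inj e)) (λ e → x≢z (p-inj e))
  }

module Embedding {m n : ℕ} {C : Ternary m} {D : Ternary n}
  (C-order : IsCircularOrdering C) (D-order : IsCircularOrdering D)
  (ι : Fin m → Fin n) (preserves : ∀ {x y z} → C x y z → D (ι x) (ι y) (ι z)) where
  open CircularOrder D-order using (C⇒≢₁₂; C⇒≢₂₃; C⇒≢₁₃)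

  reflects : ∀ {x y z} → D (ι x) (ι y) (ι z) → C x y z
  reflects h with IsCircularOrdering.total C-order (λ e → C⇒≢₁₂ h (cong ι e))
                    (λ e → C⇒≢₂₃ h (cong ι e)) (λ e → C⇒≢₁₃ h (cong ι e))
  ... | inj₁ xyz = xyz
  ... | inj₂ xzy = ⊥-elim (IsCircularOrdering.asym D-order h (preserves xzy))

  alternating-embed : ∀ {a b c d} → Alternating C a b c d → Alternating D (ι a) (ι b) (ι c) (ι d)
  alternating-embed (f₁ , f₂) =
    (λ abc bcd → f₁ (reflects abc) (reflects bcd)) ,
    (λ ¬abc → preserves (f₂ (λ abc → ¬abc (preserves abc))))

odd : ℕ → ℕ
odd q = suc (2 * q)

odd-< : ∀ {q s} → q < s → odd q < odd s
odd-< q<s = s≤s (*-monoʳ-< 2 q<s)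

odd-injective : ∀ {q s} → odd q ≡ odd s → q ≡ s
odd-injective {q} {s} e = *-cancelˡ-≡ q s 2 (suc-injective e)

odd≢suc-odd : ∀ q A → odd q ≢ suc (odd A)
odd≢suc-odd q A e = even≢odd q A (suc-injective e)

suc-odd<odd : ∀ {A q} → A < q → suc (odd A) < odd q
suc-odd<odd {A} {q} A<q = s≤s (subst (_≤ 2 * q) (*-suc 2 A) (*-monoʳ-≤ 2 A<q))

Cyc-cong : ∀ {a b c a′ b′ c′} → a ≡ a′ → b ≡ b′ → c ≡ c′ → Cyc a b c → Cyc a′ b′ c′
Cyc-cong refl refl refl h = h

Cyc-odd : ∀ {a b c} → Cyc a b c → Cyc (odd a) (odd b) (odd c)
Cyc-odd (inj₁ (a<b , b<c)) = inj₁ (odd-< a<b , odd-< b<c)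
Cyc-odd (inj₂ (inj₁ (b<c , c<a))) = inj₂ (inj₁ (odd-< b<c , odd-< c<a))
Cyc-odd (inj₂ (inj₂ (c<a , a<b))) = inj₂ (inj₂ (odd-< c<a , odd-< a<b))

Cyc-suc-odd : ∀ {A q} → q ≢ A → Cyc (odd A) (suc (odd A)) (odd q)
Cyc-suc-odd {A} {q} q≢A with <-cmp q A
... | tri< q<A _ _ = inj₂ (inj₂ (odd-< q<A , n<1+n _))
... | tri≈ _ q≡A _ = ⊥-elim (q≢A q≡A)
... | tri> _ _ A<q = inj₁ (n<1+n _ , suc-odd<odd A<q)

punchIn-view : ∀ {n} (r y : Fin (suc n)) → y ≡ r ⊎ ∃ λ x → y ≡ punchIn r x
punchIn-view r y with r ≟ y
... | yes r≡y = inj₁ (sym r≡y)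
... | no r≢y = inj₂ (punchOut r≢y , sym (punchIn-punchOut r≢y))

-- The old vertices keep their relative order at the odd positions, and the new vertex r
-- takes the even position just after odd A.
module Insertion {n : ℕ} (r : Fin (suc n)) (p : Fin n → ℕ) (p-inj : Injective _≡_ _≡_ p) (A : ℕ) where

  position : Fin (suc n) → ℕ
  position y with r ≟ y
  ... | yes _ = suc (odd A)
  ... | no r≢y = odd (p (punchOut r≢y))

  position-r : position r ≡ suc (odd A)
  position-r with r ≟ r
  ... | yes _ = refl
  ... | no r≢r = ⊥-elim (r≢r refl)

  position-punchIn : ∀ x → position (punchIn r x) ≡ odd (p x)
  position-punchIn x with r ≟ punchIn r x
  ... | yes r≡ι = ⊥-elim (punchInᵢ≢i r x (sym r≡ι))
  ... | no _ = cong (λ t → odd (p t)) (trans (punchOut-cong r refl) (punchOut-punchIn r))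

  position-injective : Injective _≡_ _≡_ position
  position-injective {x} {y} e with punchIn-view r x | punchIn-view r y
  ... | inj₁ refl | inj₁ refl = refl
  ... | inj₁ refl | inj₂ (y′ , refl) =
    ⊥-elim (odd≢suc-odd (p y′) A (trans (sym (position-punchIn y′)) (trans (sym e) position-r)))
  ... | inj₂ (x′ , refl) | inj₁ refl =
    ⊥-elim (odd≢suc-odd (p x′) A (trans (sym (position-punchIn x′)) (trans e position-r)))
  ... | inj₂ (x′ , refl) | inj₂ (y′ , refl) =
    cong (punchIn r)
         (p-inj (odd-injective (trans (sym (position-punchIn x′)) (trans e (position-punchIn y′)))))

  D : Ternary (suc n)
  D = positional position

  D-order : IsCircularOrdering D
  D-order = positional-isCircularOrdering position position-injective

  preserves : ∀ {x y z} → positional p x y z → D (punchIn r x) (punchIn r y) (punchIn r z)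
  preserves {x} {y} {z} h =
    Cyc-cong (sym (position-punchIn x)) (sym (position-punchIn y)) (sym (position-punchIn z)) (Cyc-odd h)

  immediatelyAfter : ∀ α → p α ≡ A → CircularOrder.ImmediatelyAfter D-order (punchIn r α) r
  immediatelyAfter α pα≡A z z≢α z≢r with punchIn-view r z
  ... | inj₁ z≡r = ⊥-elim (z≢r z≡r)
  ... | inj₂ (x , refl) =
    Cyc-cong (sym (trans (position-punchIn α) (cong odd pα≡A))) (sym position-r) (sym (position-punchIn x))
             (Cyc-suc-odd (λ e → z≢α (cong (punchIn r) (p-inj (trans e (sym pα≡A))))))

least : ∀ {n} {P : Fin n → Set} (R : Fin n → Fin n → Set) → (∀ y → Dec (P y)) →
  (∀ {x y z} → R x y → R y z → R x z) → (∀ {x y} → P x → P y → x ≢ y → R x y ⊎ R y x) →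
  ∃ P → Σ (Fin n) λ m → P m × (∀ y → P y → y ≢ m → R m y)
least {zero} R P? R-trans R-total (() , _)
least {suc n} {P} R P? R-trans R-total (w , pw) with any? (λ x → P? (suc x))
... | no noneAbove =
  zero , p₀ w pw , λ { zero _ 0≢0 → ⊥-elim (0≢0 refl) ; (suc y) py _ → ⊥-elim (noneAbove (y , py)) }
  where
  p₀ : ∀ w → P w → P zero
  p₀ zero pw = pw
  p₀ (suc w) pw = ⊥-elim (noneAbove (w , pw))
... | yes someAbove
  with least (λ x y → R (suc x) (suc y)) (λ x → P? (suc x)) R-trans
             (λ px py x≢y → R-total px py (λ e → x≢y (Fin-suc-injective e))) someAbove
...   | m , pm , m-least with P? zero
...     | no ¬p₀ =
  suc m , pm , λ { zero p₀ _ → ⊥-elim (¬p₀ p₀) ; (suc y) py y≢m → m-least y py (λ e → y≢m (cong suc e)) }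
...     | yes p₀ with R-total p₀ pm (λ ())
...       | inj₂ m<0 =
  suc m , pm , λ { zero _ _ → m<0 ; (suc y) py y≢m → m-least y py (λ e → y≢m (cong suc e)) }
...       | inj₁ 0<m = zero , p₀ , λ { zero _ 0≢0 → ⊥-elim (0≢0 refl) ; (suc y) py _ → below y py }
  where
  below : ∀ y → P (suc y) → R zero (suc y)
  below y py with y ≟ m
  ... | yes refl = 0<m
  ... | no y≢m = R-trans 0<m (m-least y py y≢m)

module _ {n : ℕ} (H : Graph n) {C : Ternary n} (CO : IsCircularOrdering C) where
  open Graph H renaming (sym to adj-sym)
  open IsCircularOrdering CO using (cyclic; asym; total) renaming (trans to C-trans)
  open CircularOrder CO

  -- A new leaf r attached to u and placed immediately after α turns every path r u v b
  -- into an alternating one.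
  Anchor : Fin n → Fin n → Set
  Anchor u α = ∀ {v b} → Adj u v → Adj v b → b ≢ u →
    (α ≡ u × C u v b) ⊎ (α ≡ v × ¬ C u v b) ⊎ (α ≢ u × α ≢ v × ExactlyOne (C u v α) (C u v b))

  -- If u has two neighbours, the anchor is the first neighbour of u after u itself.
  firstNeighbour-anchor : IsForest H → PathAlternating H C → ∀ {u w w₂} →
    Adj u w → Adj u w₂ → w₂ ≢ w → ∃ (Anchor u)
  firstNeighbour-anchor forest alt {u} {w} {w₂} uw uw₂ w₂≢w = α , anchor
    where
    first = least (C u) (dec u) C-trans (λ ux uy x≢y → total (adj⇒≢ H ux) x≢y (adj⇒≢ H uy)) (w , uw)
    α = proj₁ first
    uα = proj₁ (proj₂ first)
    α-first : ∀ y → Adj u y → y ≢ α → C u α y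
    α-first = proj₂ (proj₂ first)
    other : Σ (Fin n) λ v₂ → Adj u v₂ × v₂ ≢ α
    other with w ≟ α
    ... | yes w≡α = w₂ , uw₂ , (λ e → w₂≢w (trans e (sym w≡α)))
    ... | no w≢α = w , uw , w≢α
    noTriangle : ∀ {x v b} → Adj u x → Adj u v → Adj v b → x ≢ b
    noTriangle ux uv vb refl = forest⇒triangleFree H forest _ _ _ (uv , vb , ux)
    anchor : Anchor u α
    anchor {v} {b} uv vb b≢u with v ≟ α
    ... | yes refl = inj₂ (inj₁ (refl , proj₁ A (rotate² (α-first v₂ uv₂ v₂≢v))))
      where
      v₂ = proj₁ other
      uv₂ = proj₁ (proj₂ other)
      v₂≢v = proj₂ (proj₂ other)
      A = alt v₂ u v b (≢-sym (adj⇒≢ H uv₂) , v₂≢v , noTriangle uv₂ uv vb ,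
                        adj⇒≢ H uv , ≢-sym b≢u , adj⇒≢ H vb)
              (adj-sym uv₂) uv vb
    ... | no v≢α = inj₂ (inj₂ (α≢u , ≢-sym v≢α , (λ uvα → ⊥-elim (asym uαv uvα)) ,
                               (λ _ → proj₂ A (λ αuv → asym uαv (cyclic αuv)))))
      where
      α≢u = ≢-sym (adj⇒≢ H uα)
      uαv = α-first v uv v≢α
      A = alt α u v b (α≢u , ≢-sym v≢α , noTriangle uα uv vb , adj⇒≢ H uv , ≢-sym b≢u ,
                       adj⇒≢ H vb)
              (adj-sym uα) uv vb

  findAnchor : IsForest H → PathAlternating H C → ∀ u → AnchorCondition H u → ∃ (Anchor u)
  findAnchor forest alt u cond with any? (dec u)
  ... | no isolated = u , λ uv _ _ → ⊥-elim (isolated (_ , uv))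
  ... | yes (w , uw) with unique-or-another (dec u) w
  ...   | inj₂ (w₂ , uw₂ , w₂≢w) = firstNeighbour-anchor forest alt uw uw₂ w₂≢w
  ...   | inj₁ only with any? (λ b → dec w b ×-dec ¬? (b ≟ u))
  ...     | no none = u , λ uv vb b≢u → ⊥-elim (none (_ , subst (λ v → Adj v _) (only _ uv) vb , b≢u))
  ...     | yes (b₀ , wb₀ , b₀≢u) with C? u b₀ w
  ...       | yes ub₀w = w , anchor
    where
    anchor : Anchor u w
    anchor {v} {b} uv vb b≢u with only v uv
    ... | refl with cond w uw only (vb , b≢u) (wb₀ , b₀≢u)
    ...   | refl = inj₂ (inj₁ (refl , asym ub₀w))
  ...       | no ¬ub₀w = u , anchor
    where
    anchor : Anchor u u
    anchor {v} {b} uv vb b≢u with only v uv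
    ... | refl with cond w uw only (vb , b≢u) (wb₀ , b₀≢u)
    ...   | refl = inj₁ (refl , flip (≢-sym b₀≢u) (≢-sym (adj⇒≢ H wb₀)) (adj⇒≢ H uw) ¬ub₀w)

-- Caterpillar forests have alternating placements

module _ {n : ℕ} (G : Graph (suc n)) (r : Fin (suc n)) {C : Ternary n} {D : Ternary (suc n)}
  (C-order : IsCircularOrdering C) (D-order : IsCircularOrdering D)
  (preserves : ∀ {x y z} → C x y z → D (punchIn r x) (punchIn r y) (punchIn r z))
  (alt′ : PathAlternating (deleteVertex G r) C) where
  open Graph G renaming (sym to adj-sym)
  open IsCircularOrdering D-order using (cyclic; asym)
  open CircularOrder D-order
    using (ImmediatelyAfter; immediatelyAfter-forward; immediatelyAfter-backward; rotate²)
  open Embedding C-order D-order (punchIn r) preserves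

  private
    ι = punchIn r

    ι-≢ : ∀ {x y} → x ≢ y → ι x ≢ ι y
    ι-≢ x≢y e = x≢y (punchIn-injective r _ _ e)

    ι⁻¹-≢ : ∀ {x y} → ι x ≢ ι y → x ≢ y
    ι⁻¹-≢ ιx≢ιy e = ιx≢ιy (cong ι e)

  alternating-avoiding : ∀ a b c d → Distinct4 G (ι a) (ι b) (ι c) (ι d) →
    Adj (ι a) (ι b) → Adj (ι b) (ι c) → Adj (ι c) (ι d) → Alternating D (ι a) (ι b) (ι c) (ι d)
  alternating-avoiding a b c d (a≢b , a≢c , a≢d , b≢c , b≢d , c≢d) ab bc cd =
    alternating-embed
      (alt′ a b c d (ι⁻¹-≢ a≢b , ι⁻¹-≢ a≢c , ι⁻¹-≢ a≢d , ι⁻¹-≢ b≢c , ι⁻¹-≢ b≢d , ι⁻¹-≢ c≢d) ab bc cd)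

  isolated-pathAlternating : (∀ y → ¬ Adj r y) → PathAlternating G D
  isolated-pathAlternating isolated a b c d dist ab bc cd
    with punchIn-view r a | punchIn-view r b | punchIn-view r c | punchIn-view r d
  ... | inj₁ refl | _ | _ | _ = ⊥-elim (isolated b ab)
  ... | inj₂ _ | inj₁ refl | _ | _ = ⊥-elim (isolated c bc)
  ... | inj₂ _ | inj₂ _ | inj₁ refl | _ = ⊥-elim (isolated d cd)
  ... | inj₂ _ | inj₂ _ | inj₂ _ | inj₁ refl = ⊥-elim (isolated c (adj-sym cd))
  ... | inj₂ (a′ , refl) | inj₂ (b′ , refl) | inj₂ (c′ , refl) | inj₂ (d′ , refl) =
    alternating-avoiding a′ b′ c′ d′ dist ab bc cd

  leaf-pathAlternating : ∀ u α → (∀ y → Adj r y → y ≡ ι u) → Anchor (deleteVertex G r) C-order u α →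
    ImmediatelyAfter (ι α) r → PathAlternating G D
  leaf-pathAlternating u α r-leaf anchor α→r = alternating
    where
    throughLeaf : ∀ {v b} → Adj (ι u) (ι v) → Adj (ι v) (ι b) → b ≢ u →
      Alternating D r (ι u) (ι v) (ι b)
    throughLeaf {v} {b} uv vb b≢u with anchor uv vb b≢u
    ... | inj₁ (α≡u , uvb) = (λ ruv _ → asym ruv (cyclic u→r→v)) , (λ _ → preserves uvb)
      where
      u→r→v : D (ι u) r (ι v)
      u→r→v = subst (λ a → D (ι a) r (ι v)) α≡u
                    (α→r (ι v) (subst (λ a → ι v ≢ ι a) (sym α≡u) (≢-sym (adj⇒≢ G uv)))
                               (punchInᵢ≢i r v))
    ... | inj₂ (inj₁ (α≡v , ¬uvb)) =
      (λ _ uvb → ¬uvb (reflects uvb)) , (λ ¬ruv → ⊥-elim (¬ruv (cyclic v→r→u)))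
      where
      v→r→u : D (ι v) r (ι u)
      v→r→u = subst (λ a → D (ι a) r (ι u)) α≡v
                    (α→r (ι u) (subst (λ a → ι u ≢ ι a) (sym α≡v) (adj⇒≢ G uv)) (punchInᵢ≢i r u))
    ... | inj₂ (inj₂ (α≢u , α≢v , f₁ , f₂)) =
      (λ ruv uvb → f₁ (toC ruv) (reflects uvb)) ,
      (λ ¬ruv → preserves (f₂ (λ uvα → ¬ruv (fromC uvα))))
      where
      toC : D r (ι u) (ι v) → C u v α
      toC ruv =
        reflects (immediatelyAfter-backward α→r (ι-≢ (≢-sym α≢u)) (ι-≢ (≢-sym α≢v)) (cyclic ruv))
      fromC : C u v α → D r (ι u) (ι v)
      fromC uvα = rotate² (immediatelyAfter-forward α→r (punchInᵢ≢i r u) (preserves uvα))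
    startingAtLeaf : ∀ b c d → Distinct4 G r b c d → Adj r b → Adj b c → Adj c d →
      Alternating D r b c d
    startingAtLeaf b c d (_ , r≢c , r≢d , _ , b≢d , _) rb bc cd
      with r-leaf b rb | punchIn-view r c | punchIn-view r d
    ... | refl | inj₁ c≡r | _ = ⊥-elim (r≢c (sym c≡r))
    ... | refl | inj₂ _ | inj₁ d≡r = ⊥-elim (r≢d (sym d≡r))
    ... | refl | inj₂ (_ , refl) | inj₂ (_ , refl) = throughLeaf bc cd (λ e → b≢d (cong ι (sym e)))
    alternating : PathAlternating G D
    alternating a b c d dist@(_ , a≢c , _ , _ , b≢d , _) ab bc cd with punchIn-view r a | punchIn-view r d
    ... | inj₁ refl | _ = startingAtLeaf b c d dist ab bc cd
    ... | inj₂ _ | inj₁ refl =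
      alternating-reverse G D-order (distinct4-reverse G dist)
        (startingAtLeaf c b a (distinct4-reverse G dist) (adj-sym cd) (adj-sym bc) (adj-sym ab))
    ... | inj₂ (a′ , refl) | inj₂ (d′ , refl) with punchIn-view r b | punchIn-view r c
    ...   | inj₁ refl | _ = ⊥-elim (a≢c (trans (r-leaf _ (adj-sym ab)) (sym (r-leaf _ bc))))
    ...   | inj₂ _ | inj₁ refl = ⊥-elim (b≢d (trans (r-leaf _ (adj-sym bc)) (sym (r-leaf _ cd))))
    ...   | inj₂ (b′ , refl) | inj₂ (c′ , refl) = alternating-avoiding a′ b′ c′ d′ dist ab bc cd

removalCondition⇒anchorCondition : ∀ {n} (G : Graph (suc n)) r u →
  RemovalCondition G r (punchIn r u) → AnchorCondition (deleteVertex G r) u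
removalCondition⇒anchorCondition G r u cond w uw only {b} {b′} (wb , b≢u) (wb′ , b′≢u) =
  punchIn-injective r b b′
    (cond (punchIn r w) uw (punchInᵢ≢i r w) only-inG (wb , ι-≢ b≢u) (wb′ , ι-≢ b′≢u))
  where
  ι-≢ : ∀ {x y} → x ≢ y → punchIn r x ≢ punchIn r y
  ι-≢ x≢y e = x≢y (punchIn-injective r _ _ e)
  only-inG : ∀ x → Graph.Adj G (punchIn r u) x → x ≢ r → x ≡ punchIn r w
  only-inG x ux x≢r with punchIn-view r x
  ... | inj₁ x≡r = ⊥-elim (x≢r x≡r)
  ... | inj₂ (x′ , refl) = cong (punchIn r) (only x′ ux)

AlternatingPlacement : ∀ {n} → Graph n → Set
AlternatingPlacement {n} G = Σ (Fin n → ℕ) λ p → Injective _≡_ _≡_ p × PathAlternating G (positional p)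

caterpillarForest⇒placement : ∀ n (G : Graph n) → IsCaterpillarForest G → AlternatingPlacement G
caterpillarForest⇒placement zero G _ = (λ ()) , (λ { {()} }) , (λ ())
caterpillarForest⇒placement (suc n) G cf with findRemovable G cf zero
... | r , removable
  with caterpillarForest⇒placement n (deleteVertex G r) (caterpillarForest-deleteVertex G r cf)
...   | p , p-inj , alt′ = reinsert removable
  where
  C-order = positional-isCircularOrdering p p-inj
  reinsert : Removable G r → AlternatingPlacement G
  reinsert (inj₁ isolated) =
    position , position-injective , isolated-pathAlternating G r C-order D-order preserves alt′ isolated
    where open Insertion r p p-inj 0
  reinsert (inj₂ (u , ru , r-leaf , cond)) with punchIn-view r u
  ... | inj₁ u≡r = ⊥-elim (adj⇒≢ G ru (sym u≡r))
  ... | inj₂ (u′ , refl)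
    with findAnchor (deleteVertex G r) C-order (proj₁ (caterpillarForest-deleteVertex G r cf)) alt′ u′
                    (removalCondition⇒anchorCondition G r u′ cond)
  ...   | α , anchor =
    position , position-injective ,
    leaf-pathAlternating G r C-order D-order preserves alt′ u′ α r-leaf anchor (immediatelyAfter α refl)
    where open Insertion r p p-inj (p α)

caterpillarForest⇒cfOrdering : ∀ {n} (G : Graph n) → IsCaterpillarForest G → HasCFFreeCircularOrdering G
caterpillarForest⇒cfOrdering G cf@(forest , _) with caterpillarForest⇒placement _ G cf
... | p , p-inj , alt =
  positional p , C-order ,
  pathAlternating⇒cfFree G C-order (forest⇒triangleFree G forest) (forest⇒squareFree G forest) alt
  where C-order = positional-isCircularOrdering p p-inj

mainTheorem11 : (n : ℕ) (G : Graph n) →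
    (IsCaterpillarForest G → HasCFFreeCircularOrdering G) × (HasCFFreeCircularOrdering G → IsCaterpillarForest G)
mainTheorem11 n G =
  caterpillarForest⇒cfOrdering G , λ (C , C-order , cf) → cfFree⇒caterpillarForest G C-order cf
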